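{- Let $f_1:\mathbb{N}\to A_1$ and $f_2:\mathbb{N}\to A_2$ be closed terms of $\mathcal{T}$ with $A_1,A_2$ atomic, and let $\mathcal{M}$ and $\mathcal{N}$ be moduli of convergence for $f_1$ and $f_2$ respectively. Define $\mathcal{M}\sqcup\mathcal{N}:=\lambda h^{\mathbb{N}\to\mathbb{N}}\lambda z^{\mathbb{N}}.\,\mathcal{N}_h(\mathcal{M}_{h\circ\mathcal{N}_h}(z))$. Then $\mathcal{M}\sqcup\mathcal{N}$ is a modulus of convergence for both $f_1$ and $f_2$.
   Context: $\mathcal{T}$ is a simple extension of Gödel's system (simply typed $\lambda$-calculus over $\mathbb{N},\mathsf{Bool}$ with products, arrows, $0,\mathsf{S}$, booleans, conditionals, recursors in all types, possibly extended by atomic types and constants with functional reduction rules on closed normal atomic arguments). Equality is provable equality in $\mathcal{T}$; $\mathcal{M}_h$ denotes $\mathcal{M}h$ and $h\circ g:=\lambda x.h(g(x))$. For $f:\mathbb{N}\to A$ and numerals $n\le m$, $f\downarrow[n,m]$ means $f(x)=f(n)$ for all $n\le x\le m$; $h\ge\mathrm{id}$ means $h(x)\ge x$ for all numerals $x$. A closed term $\mathcal{L}:(\mathbb{N}\to\mathbb{N})\to(\mathbb{N}\to\mathbb{N})$ is a modulus of convergence for a closed $f:\mathbb{N}\to A$ ($A$ atomic) if for every closed $h:\mathbb{N}\to\mathbb{N}$ with $h\ge\mathrm{id}$: (1) $\mathcal{L}_h\ge\mathrm{id}$, and (2) $f\downarrow[\mathcal{L}_h(z),h(\mathcal{L}_h(z))]$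 for every numeral $z$. -}

module Defs where

open import Data.Nat using (ℕ; _≤_)
open import Data.Product using (_×_)
open import Relation.Binary.PropositionalEquality using (_≡_)
open import Function using (_∘_)

-- Semantic model of T-terms: a closed term of type ℕ → A is modelled by an
-- Agda function; provable equality of closed atomic terms by _≡_.
-- The closed terms of type ℕ → ℕ are modelled by an abstract class
-- `Closed : (ℕ → ℕ) → Set`.

_↓[_,_] : {A : Set} → (ℕ → A) → ℕ → ℕ → Set
f ↓[ n , m ] = ∀ x → n ≤ x → x ≤ m → f x ≡ f n

GeId : (ℕ → ℕ) → Set
GeId h = ∀ x → x ≤ h x

IsModulus : (Closed : (ℕ → ℕ) → Set) {A : Set} →
            (ℕ → A) → ((ℕ → ℕ) → (ℕ → ℕ)) → Set
IsModulus Closed f L =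
  ∀ h → Closed h → GeId h → GeId (L h) × (∀ z → f ↓[ L h z , h (L h z) ])

_⊔ₘ_ : ((ℕ → ℕ) → (ℕ → ℕ)) → ((ℕ → ℕ) → (ℕ → ℕ)) → ((ℕ → ℕ) → (ℕ → ℕ))
(M ⊔ₘ N) h z = N h (M (h ∘ N h) z)

{-# OPTIONS --safe #-}
module Submission where

open import Defs
open import Data.Nat using (ℕ; _≤_)
open import Data.Nat.Properties using (≤-refl; ≤-trans)
open import Data.Product using (_×_; _,_; proj₁; proj₂)
open import Function using (_∘_)
open import Relation.Binary.PropositionalEquality using (trans; sym)

-- For f₂ the interval produced by M ⊔ N is one produced by N itself, at the
-- point M_{h∘N_h}(z). For f₁, M_{h∘N_h} gives constancy on [a , h(N_h a)] with
-- a = M_{h∘N_h}(z), and since N_h ≥ id this interval contains [N_h a , h(N_h a)].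

GeId-∘ : {g h : ℕ → ℕ} → GeId g → GeId h → GeId (g ∘ h)
GeId-∘ {h = h} g≥id h≥id x = ≤-trans (h≥id x) (g≥id (h x))

↓-mono : {A : Set} {f : ℕ → A} {n m n′ m′ : ℕ} →
         f ↓[ n , m ] → n ≤ n′ → m′ ≤ m → f ↓[ n′ , m′ ]
↓-mono {n′ = n′} f↓ n≤n′ m′≤m x n′≤x x≤m′ =
  trans (f↓ x (≤-trans n≤n′ n′≤x) (≤-trans x≤m′ m′≤m))
        (sym (f↓ n′ n≤n′ (≤-trans n′≤x (≤-trans x≤m′ m′≤m))))

module _ (Closed : (ℕ → ℕ) → Set) where

  PreservesGeId : ((ℕ → ℕ) → (ℕ → ℕ)) → Set
  PreservesGeId L = ∀ h → Closed h → GeId h → GeId (L h)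

  IsModulus⇒PreservesGeId : {A : Set} {f : ℕ → A} {L : (ℕ → ℕ) → (ℕ → ℕ)} →
                            IsModulus Closed f L → PreservesGeId L
  IsModulus⇒PreservesGeId isMod h closed h≥id = proj₁ (isMod h closed h≥id)

  IsModulus-∘ʳ : {A : Set} {f : ℕ → A} {N G : (ℕ → ℕ) → (ℕ → ℕ)} →
                 IsModulus Closed f N → PreservesGeId G →
                 IsModulus Closed f (λ h → N h ∘ G h)
  IsModulus-∘ʳ isMod G≥id h closed h≥id =
    GeId-∘ (proj₁ (isMod h closed h≥id)) (G≥id h closed h≥id) ,
    λ z → proj₂ (isMod h closed h≥id) _

  module _ (∘-closed : ∀ g h → Closed g → Closed h → Closed (g ∘ h))
           {N : (ℕ → ℕ) → (ℕ → ℕ)}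
           (N-closed : ∀ h → Closed h → Closed (N h))
           (N≥id : PreservesGeId N) where

    ∘N-closed : ∀ h → Closed h → Closed (h ∘ N h)
    ∘N-closed h closed = ∘-closed h (N h) closed (N-closed h closed)

    ∘N-preservesGeId : ∀ h → Closed h → GeId h → GeId (h ∘ N h)
    ∘N-preservesGeId h closed h≥id = GeId-∘ h≥id (N≥id h closed h≥id)

    ⊔ₘ-preservesGeId : {M : (ℕ → ℕ) → (ℕ → ℕ)} → PreservesGeId M →
                       PreservesGeId (λ h → M (h ∘ N h))
    ⊔ₘ-preservesGeId M≥id h closed h≥id =
      M≥id (h ∘ N h) (∘N-closed h closed) (∘N-preservesGeId h closed h≥id)

    IsModulus-⊔ₘˡ : {A : Set} {f : ℕ → A} {M : (ℕ → ℕ) → (ℕ → ℕ)} →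
                    IsModulus Closed f M → IsModulus Closed f (M ⊔ₘ N)
    IsModulus-⊔ₘˡ {f = f} {M} isMod h closed h≥id =
      GeId-∘ (N≥id h closed h≥id) (proj₁ M-mod) ,
      λ z → ↓-mono (proj₂ M-mod z) (N≥id h closed h≥id (M (h ∘ N h) z)) ≤-refl
      where
      M-mod : GeId (M (h ∘ N h)) ×
              (∀ z → f ↓[ M (h ∘ N h) z , h (N h (M (h ∘ N h) z)) ])
      M-mod = isMod (h ∘ N h) (∘N-closed h closed) (∘N-preservesGeId h closed h≥id)

mainTheorem9 : (Closed : (ℕ → ℕ) → Set)
    → (∀ g h → Closed g → Closed h → Closed (g ∘ h))
    → {A₁ A₂ : Set} (f₁ : ℕ → A₁) (f₂ : ℕ → A₂)
    → (M N : (ℕ → ℕ) → (ℕ → ℕ))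
    → (∀ h → Closed h → Closed (M h))
    → (∀ h → Closed h → Closed (N h))
    → IsModulus Closed f₁ M → IsModulus Closed f₂ N
    → IsModulus Closed f₁ (M ⊔ₘ N) × IsModulus Closed f₂ (M ⊔ₘ N)
mainTheorem9 Closed ∘-closed f₁ f₂ M N _ N-closed M-mod N-mod =
  IsModulus-⊔ₘˡ Closed ∘-closed N-closed N≥id M-mod ,
  IsModulus-∘ʳ Closed N-mod
    (⊔ₘ-preservesGeId Closed ∘-closed N-closed N≥id
      (IsModulus⇒PreservesGeId Closed M-mod))
  where
  N≥id : PreservesGeId Closed N
  N≥id = IsModulus⇒PreservesGeId Closed N-mod
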